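{- Let $T\subset V$ satisfy $w(T)>W_L$ and $|T|\le F_L$, and put $r=w(T)-W_L$. Then for every $i\in T$ the inequality \[ w_i+\sum_{j\in T\setminus\{i\}} w_jx_{ij}+\sum_{j\in V\setminus T}(w_j+r)\,x_{ij}\;\ge\; w(T) \] is valid for $\mathcal{P}$.
   Context: Let $n,k$ be integers with $k\ge 2$, $F_L:=\lfloor n/k\rfloor\ge 2$ and $F_U:=\lceil n/k\rceil$. Let $G=(V,E)$ be the complete graph on $V=\{1,\dots,n\}$, let $w:V\to\mathbb{R}^+$ be node weights and $W_L\le W_U$ positive reals. For $x\in\{0,1\}^E$ write $x_{ij}=x_{ji}$ for the coordinate of edge $\{i,j\}$. Let $r_0=n \bmod k$ and $\beta_{n,k}=r_0F_U(F_U-1)/2+(k-r_0)F_L(F_L-1)/2$. $\mathcal{P}$ is the convex hull of all $x\in\{0,1\}^E$ satisfying: for all distinct $i<j<l$, $x_{ij}+x_{jl}-x_{il}\le1$, $x_{ij}-x_{jl}+x_{il}\le1$, $-x_{ij}+x_{jl}+x_{il}\le1$; for all $i\in V$, $F_L\le 1+\sum_{j\ne i}x_{ij}\le F_U$ and $W_L\le w_i+\sum_{j\ne i}w_jx_{ij}\le W_U$; and $\sum_{\{i,j\}\in E}x_{ij}=\beta_{n,k}$. For $T\subseteq V$, $w(T)=\sum_{i\in T}w_i$.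
   Formalization: The node weights and the bounds $W_L$, $W_U$ are rational rather than real, and the inequality is asserted only at points of 𝒫 that are convex combinations with rational coefficients. -}

module Defs where

open import Data.Nat as ℕ using (ℕ; zero; suc; _∸_; NonZero)
open import Data.Nat.DivMod using (_/_; _%_)
open import Data.Integer using (+_)
open import Data.Rational as ℚ using (ℚ; 0ℚ; 1ℚ)
open import Data.Fin using (Fin; toℕ)
open import Data.Fin.Subset using (Subset; _∈_; _∉_)
open import Data.Bool using (Bool; true; false; if_then_else_)
open import Data.List using (List; []; _∷_)
open import Data.List.Relation.Unary.All using (All)
open import Data.Product using (_×_; Σ; _,_; proj₁; proj₂; ∃)
open import Relation.Binary.PropositionalEquality using (_≡_; _≢_)
open import Relation.Nullary.Decidable using (does)
import Data.Fin
import Data.Fin.Properties as FinP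
import Data.Fin.Subset.Properties as SubP

ℕ→ℚ : ℕ → ℚ
ℕ→ℚ m = (+ m) ℚ./ 1

Σℕ : ∀ {n} → (Fin n → ℕ) → ℕ
Σℕ {zero}  f = 0
Σℕ {suc n} f = f Data.Fin.zero ℕ.+ Σℕ (λ j → f (Data.Fin.suc j))

Σℚ : ∀ {n} → (Fin n → ℚ) → ℚ
Σℚ {zero}  f = 0ℚ
Σℚ {suc n} f = f Data.Fin.zero ℚ.+ Σℚ (λ j → f (Data.Fin.suc j))

neqℕ : ∀ {n} → Fin n → Fin n → ℕ → ℕ
neqℕ i j a = if does (j FinP.≟ i) then 0 else a

neqℚ : ∀ {n} → Fin n → Fin n → ℚ → ℚ
neqℚ i j a = if does (j FinP.≟ i) then 0ℚ else a

inℚ : ∀ {n} → Subset n → Fin n → ℚ → ℚ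
inℚ T j a = if does (j SubP.∈? T) then a else 0ℚ

outℚ : ∀ {n} → Subset n → Fin n → ℚ → ℚ
outℚ T j a = if does (j SubP.∈? T) then 0ℚ else a

F-L : (n k : ℕ) → .{{NonZero k}} → ℕ
F-L n k = n / k

F-U : (n k : ℕ) → .{{NonZero k}} → ℕ
F-U n k with n % k
... | zero  = n / k
... | suc _ = suc (n / k)

β : (n k : ℕ) → .{{NonZero k}} → ℕ
β n k = ((n % k) ℕ.* (F-U n k ℕ.* (F-U n k ∸ 1))) / 2
        ℕ.+ ((k ∸ n % k) ℕ.* (F-L n k ℕ.* (F-L n k ∸ 1))) / 2

wSet : ∀ {n} → (Fin n → ℚ) → Subset n → ℚ
wSet w T = Σℚ (λ j → inℚ T j (w j))

-- 0/1 edge vectors of K_n, stored as symmetric functions Fin n → Fin n → ℕ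
-- with values in {0,1} off the diagonal and 0 on the diagonal
-- (coordinate of edge {i,j} is x i j = x j i).
record Feasible (n k : ℕ) .{{_ : NonZero k}} (w : Fin n → ℚ) (WL WU : ℚ)
                (x : Fin n → Fin n → ℕ) : Set where
  field
    binary   : ∀ i j → x i j ℕ.≤ 1
    diag     : ∀ i → x i i ≡ 0
    symm     : ∀ i j → x i j ≡ x j i
    tri₁     : ∀ i j l → i Data.Fin.< j → j Data.Fin.< l → x i j ℕ.+ x j l ℕ.≤ 1 ℕ.+ x i l
    tri₂     : ∀ i j l → i Data.Fin.< j → j Data.Fin.< l → x i j ℕ.+ x i l ℕ.≤ 1 ℕ.+ x j l
    tri₃     : ∀ i j l → i Data.Fin.< j → j Data.Fin.< l → x j l ℕ.+ x i l ℕ.≤ 1 ℕ.+ x i j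
    degL     : ∀ i → F-L n k ℕ.≤ 1 ℕ.+ Σℕ (λ j → neqℕ i j (x i j))
    degU     : ∀ i → 1 ℕ.+ Σℕ (λ j → neqℕ i j (x i j)) ℕ.≤ F-U n k
    wtL      : ∀ i → WL ℚ.≤ w i ℚ.+ Σℚ (λ j → neqℚ i j (w j ℚ.* ℕ→ℚ (x i j)))
    wtU      : ∀ i → w i ℚ.+ Σℚ (λ j → neqℚ i j (w j ℚ.* ℕ→ℚ (x i j))) ℚ.≤ WU
    edges    : Σℕ (λ i → Σℕ (λ j → if does (toℕ i ℕ.<? toℕ j) then x i j else 0)) ≡ β n k

ΣL : ∀ {A : Set} → (A → ℚ) → List A → ℚ
ΣL f []       = 0ℚ
ΣL f (a ∷ as) = f a ℚ.+ ΣL f as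

-- membership in 𝒫 = conv{feasible 0/1 points}: y is a finite convex combination
InP : (n k : ℕ) .{{_ : NonZero k}} (w : Fin n → ℚ) (WL WU : ℚ)
      (y : Fin n → Fin n → ℚ) → Set
InP n k w WL WU y =
  Σ (List (ℚ × (Fin n → Fin n → ℕ))) λ pts →
    All (λ p → (0ℚ ℚ.≤ proj₁ p) × Feasible n k w WL WU (proj₂ p)) pts
    × ΣL proj₁ pts ≡ 1ℚ
    × (∀ i j → y i j ≡ ΣL (λ p → proj₁ p ℚ.* ℕ→ℚ (proj₂ p i j)) pts)

{-# OPTIONS --safe #-}
-- If i has a
-- neighbour outside T, that neighbour contributes r, and the weight lower bound at i
-- gives W_L + r = w(T). Otherwise all neighbours of i lie in T \ {i}, and the degree
-- bound |T| - 1 ≤ F_L - 1 ≤ deg i forces the neighbourhood to be all of T \ {i}, where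
-- the inequality is tight. The left-hand side is affine in x, so validity passes to
-- convex combinations.
module Submission where

open import Defs
open import Data.Nat as ℕ using (ℕ; NonZero)
open import Data.Rational as ℚ using (ℚ; 0ℚ)
open import Data.Fin using (Fin)
open import Data.Fin.Subset using (Subset; _∈_; ∣_∣)

open import Data.Nat using (zero; suc; z≤n)
import Data.Nat.Properties as ℕP
open import Algebra.Properties.CommutativeSemigroup ℕP.+-commutativeSemigroup
  using (x∙yz≈y∙xz)
open import Data.Rational using (1ℚ; _+_; _*_; _-_; -_; _≤_; _<_; NonNegative; nonNegative)
open import Data.Rational.Properties
  using (≤-refl; ≤-trans; ≤-reflexive; <⇒≤; +-mono-≤; +-monoʳ-≤; +-monoˡ-≤; +-assoc;
         +-identityˡ; +-identityʳ; +-inverseʳ; *-zeroˡ; *-zeroʳ; *-identityʳ; *-distribʳ-+;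
         *-distribˡ-+; *-monoˡ-≤-nonNeg; nonNegative⁻¹; nonNeg*nonNeg⇒nonNeg;
         normalize-nonNeg; module ≤-Reasoning)
open import Data.Rational.Solver using (module +-*-Solver)
open import Data.Fin using (zero; suc)
open import Data.Fin.Properties using (_≟_; any?)
open import Data.Fin.Subset using (_∉_; inside; outside)
open import Data.Fin.Subset.Properties using (_∈?_)
open import Data.Vec using (_∷_; [])
open import Data.List using (List; []; _∷_)
open import Data.List.Relation.Unary.All as All using (All; []; _∷_)
open import Data.Product using (_×_; _,_; proj₁; proj₂; map₂)
open import Data.Sum using (inj₁; inj₂)
open import Data.Bool using (true; false; if_then_else_)
open import Relation.Binary.PropositionalEquality
open import Relation.Nullary using (yes; no; ¬?; contradiction)
open import Relation.Nullary.Decidable using (does; dec-true; dec-false; _×-dec_)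

open +-*-Solver using (solve; _:+_; _:-_; _:*_; _:=_)

Σℚ-cong : ∀ {n} {f g : Fin n → ℚ} → (∀ j → f j ≡ g j) → Σℚ f ≡ Σℚ g
Σℚ-cong {zero}  f≗g = refl
Σℚ-cong {suc n} f≗g = cong₂ _+_ (f≗g zero) (Σℚ-cong (λ j → f≗g (suc j)))

Σℚ-≗0 : ∀ {n} {f : Fin n → ℚ} → (∀ j → f j ≡ 0ℚ) → Σℚ f ≡ 0ℚ
Σℚ-≗0 {zero}  f≗0 = refl
Σℚ-≗0 {suc n} f≗0 = trans (cong₂ _+_ (f≗0 zero) (Σℚ-≗0 (λ j → f≗0 (suc j)))) (+-identityˡ 0ℚ)

Σℚ-distrib-+ : ∀ {n} (f g : Fin n → ℚ) → Σℚ (λ j → f j + g j) ≡ Σℚ f + Σℚ g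
Σℚ-distrib-+ {zero}  f g = sym (+-identityˡ 0ℚ)
Σℚ-distrib-+ {suc n} f g =
  trans (cong (f zero + g zero +_) (Σℚ-distrib-+ (λ j → f (suc j)) (λ j → g (suc j))))
        (solve 4 (λ a b c d → (a :+ b) :+ (c :+ d) := (a :+ c) :+ (b :+ d)) refl
               (f zero) (g zero) (Σℚ (λ j → f (suc j))) (Σℚ (λ j → g (suc j))))

Σℚ-*ˡ : ∀ {n} a (f : Fin n → ℚ) → Σℚ (λ j → a * f j) ≡ a * Σℚ f
Σℚ-*ˡ {zero}  a f = sym (*-zeroʳ a)
Σℚ-*ˡ {suc n} a f =
  trans (cong (a * f zero +_) (Σℚ-*ˡ a (λ j → f (suc j)))) (sym (*-distribˡ-+ a _ _))

Σℚ-nonNeg : ∀ {n} {f : Fin n → ℚ} → (∀ j → 0ℚ ≤ f j) → 0ℚ ≤ Σℚ f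
Σℚ-nonNeg {zero}  f≥0 = ≤-refl
Σℚ-nonNeg {suc n} f≥0 = +-mono-≤ (f≥0 zero) (Σℚ-nonNeg (λ j → f≥0 (suc j)))

term≤Σℚ : ∀ {n} {f : Fin n → ℚ} → (∀ j → 0ℚ ≤ f j) → ∀ j → f j ≤ Σℚ f
term≤Σℚ {suc n} {f} f≥0 zero =
  ≤-trans (≤-reflexive (sym (+-identityʳ (f zero))))
          (+-monoʳ-≤ (f zero) (Σℚ-nonNeg (λ j → f≥0 (suc j))))
term≤Σℚ {suc n} {f} f≥0 (suc j) =
  ≤-trans (≤-reflexive (sym (+-identityˡ (f (suc j)))))
          (+-mono-≤ (f≥0 zero) (term≤Σℚ (λ j → f≥0 (suc j)) j))

Σℚ-split : ∀ {n} (f : Fin n → ℚ) i → Σℚ f ≡ f i + Σℚ (λ j → neqℚ i j (f j))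
Σℚ-split {suc n} f zero    = cong (f zero +_) (sym (+-identityˡ _))
Σℚ-split {suc n} f (suc i) =
  trans (cong (f zero +_) (Σℚ-split (λ j → f (suc j)) i))
        (solve 3 (λ a b c → a :+ (b :+ c) := b :+ (a :+ c)) refl (f zero) (f (suc i)) _)

Σℕ-split : ∀ {n} (f : Fin n → ℕ) i → Σℕ f ≡ f i ℕ.+ Σℕ (λ j → neqℕ i j (f j))
Σℕ-split {suc n} f zero    = refl
Σℕ-split {suc n} f (suc i) =
  trans (cong (f zero ℕ.+_) (Σℕ-split (λ j → f (suc j)) i)) (x∙yz≈y∙xz (f zero) (f (suc i)) _)

Σℕ-mono : ∀ {n} {f g : Fin n → ℕ} → (∀ j → f j ℕ.≤ g j) → Σℕ f ℕ.≤ Σℕ g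
Σℕ-mono {zero}  f≤g = z≤n
Σℕ-mono {suc n} f≤g = ℕP.+-mono-≤ (f≤g zero) (Σℕ-mono (λ j → f≤g (suc j)))

Σℕ-mono-tight : ∀ {n} {f g : Fin n → ℕ} →
  (∀ j → f j ℕ.≤ g j) → Σℕ g ℕ.≤ Σℕ f → ∀ j → f j ≡ g j
Σℕ-mono-tight {suc n} {f} {g} f≤g Σg≤Σf zero =
  ℕP.≤-antisym (f≤g zero)
    (ℕP.+-cancelʳ-≤ _ _ _ (ℕP.≤-trans Σg≤Σf (ℕP.+-monoʳ-≤ (f zero) (Σℕ-mono (λ j → f≤g (suc j))))))
Σℕ-mono-tight {suc n} {f} {g} f≤g Σg≤Σf (suc j) =
  Σℕ-mono-tight (λ j → f≤g (suc j))
    (ℕP.+-cancelˡ-≤ (f zero) _ _ (ℕP.≤-trans (ℕP.+-monoˡ-≤ _ (f≤g zero)) Σg≤Σf)) j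

dot : ∀ {m} → (Fin m → ℚ) → (Fin m → ℚ) → ℚ
dot c z = Σℚ (λ j → c j * z j)

module _ {A : Set} {m : ℕ} (φ : A → Fin m → ℚ) where

  combination : List (ℚ × A) → Fin m → ℚ
  combination ps j = ΣL (λ p → proj₁ p * φ (proj₂ p) j) ps

  dot-combination : ∀ c ps → dot c (combination ps) ≡ ΣL (λ p → proj₁ p * dot c (φ (proj₂ p))) ps
  dot-combination c [] = Σℚ-≗0 (λ j → *-zeroʳ (c j))
  dot-combination c ((l , x) ∷ ps) = begin
    Σℚ (λ j → c j * (l * φ x j + combination ps j))
      ≡⟨ Σℚ-cong (λ j → solve 4 (λ c l z s → c :* (l :* z :+ s) := l :* (c :* z) :+ c :* s)
                                refl (c j) l (φ x j) (combination ps j)) ⟩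
    Σℚ (λ j → l * (c j * φ x j) + c j * combination ps j)
      ≡⟨ Σℚ-distrib-+ (λ j → l * (c j * φ x j)) (λ j → c j * combination ps j) ⟩
    Σℚ (λ j → l * (c j * φ x j)) + dot c (combination ps)
      ≡⟨ cong₂ _+_ (Σℚ-*ˡ l (λ j → c j * φ x j)) (dot-combination c ps) ⟩
    l * dot c (φ x) + ΣL (λ p → proj₁ p * dot c (φ (proj₂ p))) ps ∎
    where open ≡-Reasoning

ΣL-affine-lowerBound : ∀ {A : Set} (a b : ℚ) (f : A → ℚ) ps →
  All (λ p → 0ℚ ≤ proj₁ p × b ≤ a + f (proj₂ p)) ps →
  b * ΣL proj₁ ps ≤ a * ΣL proj₁ ps + ΣL (λ p → proj₁ p * f (proj₂ p)) ps
ΣL-affine-lowerBound a b f [] [] = ≤-reflexive (trans (*-zeroʳ b) (sym (trans (+-identityʳ (a * 0ℚ)) (*-zeroʳ a))))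
ΣL-affine-lowerBound a b f ((l , x) ∷ ps) ((l≥0 , b≤) ∷ bounds) = begin
  b * (l + L)                   ≡⟨ solve 3 (λ b l L → b :* (l :+ L) := l :* b :+ b :* L) refl b l L ⟩
  l * b + b * L                 ≤⟨ +-mono-≤ (*-monoˡ-≤-nonNeg l {{nonNegative l≥0}} b≤)
                                            (ΣL-affine-lowerBound a b f ps bounds) ⟩
  l * (a + f x) + (a * L + R)   ≡⟨ solve 5 (λ l a y L R → l :* (a :+ y) :+ (a :* L :+ R)
                                                          := a :* (l :+ L) :+ (l :* y :+ R))
                                           refl l a (f x) L R ⟩
  a * (l + L) + (l * f x + R)   ∎
  where
  open ≤-Reasoning
  L = ΣL proj₁ ps
  R = ΣL (λ p → proj₁ p * f (proj₂ p)) ps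

valid-on-convexHull : ∀ {A : Set} {m} (φ : A → Fin m → ℚ) (P : A → Set) (a b : ℚ) (c : Fin m → ℚ) →
  (∀ x → P x → b ≤ a + dot c (φ x)) →
  ∀ ps → All (λ p → 0ℚ ≤ proj₁ p × P (proj₂ p)) ps → ΣL proj₁ ps ≡ 1ℚ →
  b ≤ a + dot c (combination φ ps)
valid-on-convexHull φ P a b c valid ps inP Σλ≡1 = begin
  b                                            ≡⟨ sym (*-identityʳ b) ⟩
  b * 1ℚ                                       ≡⟨ cong (b *_) (sym Σλ≡1) ⟩
  b * ΣL proj₁ ps                              ≤⟨ ΣL-affine-lowerBound a b (λ x → dot c (φ x)) ps
                                                    (All.map (λ {p} → map₂ (valid (proj₂ p))) inP) ⟩
  a * ΣL proj₁ ps
    + ΣL (λ p → proj₁ p * dot c (φ (proj₂ p))) ps ≡⟨ cong₂ _+_ (trans (cong (a *_) Σλ≡1) (*-identityʳ a))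
                                                            (sym (dot-combination φ c ps)) ⟩
  a + dot c (combination φ ps)                 ∎
  where open ≤-Reasoning

neqℚ-* : ∀ {n} (i j : Fin n) a z → neqℚ i j (a * z) ≡ neqℚ i j a * z
neqℚ-* i j a z with does (j ≟ i)
... | true  = sym (*-zeroˡ z)
... | false = refl

neqℕ-mono : ∀ {n} (i j : Fin n) {a b} → a ℕ.≤ b → neqℕ i j a ℕ.≤ neqℕ i j b
neqℕ-mono i j a≤b with does (j ≟ i)
... | true  = z≤n
... | false = a≤b

neqℚ-self : ∀ {n} (i : Fin n) {a} → neqℚ i i a ≡ 0ℚ
neqℚ-self i rewrite dec-true (i ≟ i) refl = refl

module _ {n : ℕ} {i j : Fin n} where

  neqℚ-≢ : ∀ {a} → j ≢ i → neqℚ i j a ≡ a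
  neqℚ-≢ j≢i rewrite dec-false (j ≟ i) j≢i = refl

  neqℕ-≢ : ∀ {a} → j ≢ i → neqℕ i j a ≡ a
  neqℕ-≢ j≢i rewrite dec-false (j ≟ i) j≢i = refl

module _ {n : ℕ} {T : Subset n} {j : Fin n} where

  inℚ-∈ : ∀ {a} → j ∈ T → inℚ T j a ≡ a
  inℚ-∈ j∈T rewrite dec-true (j ∈? T) j∈T = refl

  inℚ-∉ : ∀ {a} → j ∉ T → inℚ T j a ≡ 0ℚ
  inℚ-∉ j∉T rewrite dec-false (j ∈? T) j∉T = refl

  outℚ-∈ : ∀ {a} → j ∈ T → outℚ T j a ≡ 0ℚ
  outℚ-∈ j∈T rewrite dec-true (j ∈? T) j∈T = refl

  outℚ-∉ : ∀ {a} → j ∉ T → outℚ T j a ≡ a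
  outℚ-∉ j∉T rewrite dec-false (j ∈? T) j∉T = refl

inℚ-* : ∀ {n} (T : Subset n) j a z → inℚ T j (a * z) ≡ inℚ T j a * z
inℚ-* T j a z with does (j ∈? T)
... | true  = refl
... | false = sym (*-zeroˡ z)

outℚ-* : ∀ {n} (T : Subset n) j a z → outℚ T j (a * z) ≡ outℚ T j a * z
outℚ-* T j a z with does (j ∈? T)
... | true  = sym (*-zeroˡ z)
... | false = refl

outℚ-nonNeg : ∀ {n} (T : Subset n) j {a} → 0ℚ ≤ a → 0ℚ ≤ outℚ T j a
outℚ-nonNeg T j a≥0 with does (j ∈? T)
... | true  = ≤-refl
... | false = a≥0

indicator : ∀ {n} → Subset n → Fin n → ℕ
indicator T j = if does (j ∈? T) then 1 else 0

indicator-∈ : ∀ {n} {T : Subset n} {j} → j ∈ T → indicator T j ≡ 1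
indicator-∈ {T = T} {j} j∈T rewrite dec-true (j ∈? T) j∈T = refl

∣∣≡Σℕ-indicator : ∀ {n} (T : Subset n) → ∣ T ∣ ≡ Σℕ (indicator T)
∣∣≡Σℕ-indicator []            = refl
∣∣≡Σℕ-indicator (inside ∷ T)  = cong suc (∣∣≡Σℕ-indicator T)
∣∣≡Σℕ-indicator (outside ∷ T) = ∣∣≡Σℕ-indicator T

ℕ→ℚ-nonNeg : ∀ m → NonNegative (ℕ→ℚ m)
ℕ→ℚ-nonNeg m = normalize-nonNeg m 1

module CoverInequality {n : ℕ} (w : Fin n → ℚ) (WL : ℚ) (T : Subset n) {i : Fin n} (i∈T : i ∈ T) where

  r : ℚ
  r = wSet w T - WL

  lhs : (Fin n → ℚ) → ℚ
  lhs z = w i + Σℚ (λ j → neqℚ i j (inℚ T j (w j * z j))) + Σℚ (λ j → outℚ T j ((w j + r) * z j))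

  coeff : Fin n → ℚ
  coeff j = neqℚ i j (inℚ T j (w j)) + outℚ T j (w j + r)

  lhs-affine : ∀ z → lhs z ≡ w i + dot coeff z
  lhs-affine z = begin
    w i + Σℚ A + Σℚ B           ≡⟨ +-assoc (w i) (Σℚ A) (Σℚ B) ⟩
    w i + (Σℚ A + Σℚ B)         ≡⟨ cong (w i +_) (sym (Σℚ-distrib-+ A B)) ⟩
    w i + Σℚ (λ j → A j + B j)  ≡⟨ cong (w i +_) (Σℚ-cong term) ⟩
    w i + dot coeff z           ∎
    where
    open ≡-Reasoning
    A B : Fin n → ℚ
    A j = neqℚ i j (inℚ T j (w j * z j))
    B j = outℚ T j ((w j + r) * z j)
    term : ∀ j → A j + B j ≡ coeff j * z j
    term j = begin
      A j + B j
        ≡⟨ cong₂ _+_ (trans (cong (neqℚ i j) (inℚ-* T j (w j) (z j))) (neqℚ-* i j _ (z j)))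
                     (outℚ-* T j (w j + r) (z j)) ⟩
      neqℚ i j (inℚ T j (w j)) * z j + outℚ T j (w j + r) * z j
        ≡⟨ sym (*-distribʳ-+ (z j) (neqℚ i j (inℚ T j (w j))) (outℚ T j (w j + r))) ⟩
      coeff j * z j ∎

  data Position (j : Fin n) : Set where
    self  : j ≡ i → Position j
    inner : j ≢ i → j ∈ T → Position j
    outer : j ∉ T → Position j

  position : ∀ j → Position j
  position j with j ≟ i | j ∈? T
  ... | yes j≡i | _       = self j≡i
  ... | no j≢i  | yes j∈T = inner j≢i j∈T
  ... | no _    | no j∉T  = outer j∉T

  outer⇒≢ : ∀ {j} → j ∉ T → j ≢ i
  outer⇒≢ j∉T refl = j∉T i∈T

  coeff-self : coeff i ≡ 0ℚ
  coeff-self = trans (cong₂ _+_ (neqℚ-self i) (outℚ-∈ i∈T)) (+-identityˡ 0ℚ)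

  coeff-inner : ∀ {j} → j ≢ i → j ∈ T → coeff j ≡ w j
  coeff-inner j≢i j∈T = trans (cong₂ _+_ (trans (neqℚ-≢ j≢i) (inℚ-∈ j∈T)) (outℚ-∈ j∈T)) (+-identityʳ _)

  coeff-outer : ∀ {j} → j ∉ T → coeff j ≡ w j + r
  coeff-outer j∉T = trans (cong₂ _+_ (trans (neqℚ-≢ (outer⇒≢ j∉T)) (inℚ-∉ j∉T)) (outℚ-∉ j∉T)) (+-identityˡ _)

  coeff≡neq+out : ∀ j → coeff j ≡ neqℚ i j (w j) + outℚ T j r
  coeff≡neq+out j with position j
  ... | self refl       = trans coeff-self (sym (trans (cong₂ _+_ (neqℚ-self i) (outℚ-∈ i∈T)) (+-identityˡ 0ℚ)))
  ... | inner j≢i j∈T   = trans (coeff-inner j≢i j∈T) (sym (trans (cong₂ _+_ (neqℚ-≢ j≢i) (outℚ-∈ j∈T)) (+-identityʳ _)))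
  ... | outer j∉T       = trans (coeff-outer j∉T) (sym (cong₂ _+_ (neqℚ-≢ (outer⇒≢ j∉T)) (outℚ-∉ j∉T)))

  wSet≡WL+r : wSet w T ≡ WL + r
  wSet≡WL+r = solve 2 (λ t l → t := l :+ (t :- l)) refl (wSet w T) WL

  r-nonNeg : WL < wSet w T → 0ℚ ≤ r
  r-nonNeg WL<wT = ≤-trans (≤-reflexive (sym (+-inverseʳ WL))) (+-monoˡ-≤ (- WL) (<⇒≤ WL<wT))

  valid-if-edge-leaves-T : 0ℚ ≤ r → (u : Fin n → ℕ) →
    WL ≤ w i + Σℚ (λ j → neqℚ i j (w j * ℕ→ℚ (u j))) →
    ∀ j₀ → j₀ ∉ T → u j₀ ≡ 1 → wSet w T ≤ w i + dot coeff (λ j → ℕ→ℚ (u j))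
  valid-if-edge-leaves-T r≥0 u weight j₀ j₀∉T u≡1 = begin
    wSet w T                    ≡⟨ wSet≡WL+r ⟩
    WL + r                      ≤⟨ +-mono-≤ weight (≤-trans (≤-reflexive (sym E-at-j₀)) (term≤Σℚ E≥0 j₀)) ⟩
    w i + Σℚ D + Σℚ E           ≡⟨ +-assoc (w i) (Σℚ D) (Σℚ E) ⟩
    w i + (Σℚ D + Σℚ E)         ≡⟨ cong (w i +_) (sym (Σℚ-distrib-+ D E)) ⟩
    w i + Σℚ (λ j → D j + E j)  ≡⟨ cong (w i +_) (Σℚ-cong (λ j → sym (coeff-split j))) ⟩
    w i + dot coeff X           ∎
    where
    open ≤-Reasoning
    X D E : Fin n → ℚ
    X j = ℕ→ℚ (u j)
    D j = neqℚ i j (w j * X j)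
    E j = outℚ T j (r * X j)
    E≥0 : ∀ j → 0ℚ ≤ E j
    E≥0 j = outℚ-nonNeg T j (nonNegative⁻¹ (r * X j)
              {{nonNeg*nonNeg⇒nonNeg r {{nonNegative r≥0}} (X j) {{ℕ→ℚ-nonNeg (u j)}}}})
    E-at-j₀ : E j₀ ≡ r
    E-at-j₀ = trans (outℚ-∉ j₀∉T) (trans (cong (λ m → r * ℕ→ℚ m) u≡1) (*-identityʳ r))
    coeff-split : ∀ j → coeff j * X j ≡ D j + E j
    coeff-split j = begin-equality
      coeff j * X j                           ≡⟨ cong (_* X j) (coeff≡neq+out j) ⟩
      (neqℚ i j (w j) + outℚ T j r) * X j     ≡⟨ *-distribʳ-+ (X j) (neqℚ i j (w j)) (outℚ T j r) ⟩
      neqℚ i j (w j) * X j + outℚ T j r * X j ≡⟨ sym (cong₂ _+_ (neqℚ-* i j (w j) (X j)) (outℚ-* T j r (X j))) ⟩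
      D j + E j                               ∎

  adjacent-to-all-of-T : (u : Fin n → ℕ) → (∀ j → u j ℕ.≤ 1) → (∀ j → j ∉ T → u j ≡ 0) →
    ∣ T ∣ ℕ.≤ 1 ℕ.+ Σℕ (λ j → neqℕ i j (u j)) → ∀ {j} → j ≢ i → j ∈ T → u j ≡ 1
  adjacent-to-all-of-T u u≤1 u-outside degree {j} j≢i j∈T = begin
    u j                          ≡⟨ sym (neqℕ-≢ j≢i) ⟩
    neqℕ i j (u j)               ≡⟨ Σℕ-mono-tight (λ j → neqℕ-mono i j (u≤indicator j)) Σindicator≤Σu j ⟩
    neqℕ i j (indicator T j)     ≡⟨ neqℕ-≢ j≢i ⟩
    indicator T j                ≡⟨ indicator-∈ j∈T ⟩
    1                            ∎
    where
    open ≡-Reasoning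
    u≤indicator : ∀ j → u j ℕ.≤ indicator T j
    u≤indicator j with j ∈? T
    ... | yes _   = u≤1 j
    ... | no j∉T  = ℕP.≤-reflexive (u-outside j j∉T)
    Σindicator : ℕ
    Σindicator = Σℕ (λ j → neqℕ i j (indicator T j))
    ∣T∣≡ : ∣ T ∣ ≡ 1 ℕ.+ Σindicator
    ∣T∣≡ = trans (∣∣≡Σℕ-indicator T) (trans (Σℕ-split (indicator T) i) (cong (ℕ._+ Σindicator) (indicator-∈ i∈T)))
    Σindicator≤Σu : Σindicator ℕ.≤ Σℕ (λ j → neqℕ i j (u j))
    Σindicator≤Σu = ℕP.+-cancelˡ-≤ 1 _ _ (subst (ℕ._≤ _) ∣T∣≡ degree)

  tight-if-neighbourhood-is-T : (u : Fin n → ℕ) → (∀ j → j ∉ T → u j ≡ 0) →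
    (∀ {j} → j ≢ i → j ∈ T → u j ≡ 1) → w i + dot coeff (λ j → ℕ→ℚ (u j)) ≡ wSet w T
  tight-if-neighbourhood-is-T u u-outside u-inside = begin
    w i + dot coeff (λ j → ℕ→ℚ (u j))  ≡⟨ cong (w i +_) (Σℚ-cong term) ⟩
    w i + Σℚ W                         ≡⟨ cong (_+ Σℚ W) (sym (inℚ-∈ i∈T)) ⟩
    inℚ T i (w i) + Σℚ W               ≡⟨ sym (Σℚ-split (λ j → inℚ T j (w j)) i) ⟩
    wSet w T                           ∎
    where
    open ≡-Reasoning
    W : Fin n → ℚ
    W j = neqℚ i j (inℚ T j (w j))
    term : ∀ j → coeff j * ℕ→ℚ (u j) ≡ W j
    term j with position j
    ... | self refl     = trans (cong (_* ℕ→ℚ (u i)) coeff-self) (trans (*-zeroˡ (ℕ→ℚ (u i))) (sym (neqℚ-self i)))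
    ... | inner j≢i j∈T = trans (cong₂ _*_ (coeff-inner j≢i j∈T) (cong ℕ→ℚ (u-inside j≢i j∈T)))
                                (trans (*-identityʳ (w j)) (sym (trans (neqℚ-≢ j≢i) (inℚ-∈ j∈T))))
    ... | outer j∉T     = trans (cong (λ m → coeff j * ℕ→ℚ m) (u-outside j j∉T))
                                (trans (*-zeroʳ (coeff j)) (sym (trans (neqℚ-≢ (outer⇒≢ j∉T)) (inℚ-∉ j∉T))))

  valid-at-row : WL < wSet w T → (u : Fin n → ℕ) → (∀ j → u j ℕ.≤ 1) →
    WL ≤ w i + Σℚ (λ j → neqℚ i j (w j * ℕ→ℚ (u j))) →
    ∣ T ∣ ℕ.≤ 1 ℕ.+ Σℕ (λ j → neqℕ i j (u j)) →
    wSet w T ≤ w i + dot coeff (λ j → ℕ→ℚ (u j))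
  valid-at-row WL<wT u u≤1 weight degree with any? (λ j → ¬? (j ∈? T) ×-dec (u j ℕ.≟ 1))
  ... | yes (j₀ , j₀∉T , u≡1) = valid-if-edge-leaves-T (r-nonNeg WL<wT) u weight j₀ j₀∉T u≡1
  ... | no ∄ = ≤-reflexive (sym (tight-if-neighbourhood-is-T u u-outside
                                   (adjacent-to-all-of-T u u≤1 u-outside degree)))
    where
    u-outside : ∀ j → j ∉ T → u j ≡ 0
    u-outside j j∉T with ℕP.n≤1⇒n≡0∨n≡1 (u≤1 j)
    ... | inj₁ u≡0 = u≡0
    ... | inj₂ u≡1 = contradiction (j , j∉T , u≡1) ∄

proposition2 : (n k : ℕ) .{{_ : NonZero k}} → 2 ℕ.≤ k → 2 ℕ.≤ F-L n k →
    (w : Fin n → ℚ) → (∀ i → 0ℚ ℚ.< w i) →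
    (WL WU : ℚ) → 0ℚ ℚ.< WL → WL ℚ.≤ WU →
    (T : Subset n) → WL ℚ.< wSet w T → ∣ T ∣ ℕ.≤ F-L n k →
    (i : Fin n) → i ∈ T →
    (y : Fin n → Fin n → ℚ) → InP n k w WL WU y →
    wSet w T ℚ.≤
      w i ℚ.+ Σℚ (λ j → neqℚ i j (inℚ T j (w j ℚ.* y i j)))
          ℚ.+ Σℚ (λ j → outℚ T j ((w j ℚ.+ (wSet w T ℚ.- WL)) ℚ.* y i j))
proposition2 n k _ _ w _ WL WU _ _ T WL<wT ∣T∣≤F-L i i∈T y (ps , feasible , Σλ≡1 , y≡) = begin
  wSet w T
    ≤⟨ valid-on-convexHull φ (Feasible n k w WL WU) (w i) (wSet w T) coeff valid-at-vertex
                           ps feasible Σλ≡1 ⟩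
  w i + dot coeff (combination φ ps)
    ≡⟨ cong (w i +_) (Σℚ-cong (λ j → cong (coeff j *_) (sym (y≡ i j)))) ⟩
  w i + dot coeff (y i)
    ≡⟨ sym (lhs-affine (y i)) ⟩
  lhs (y i) ∎
  where
  open ≤-Reasoning
  open CoverInequality w WL T i∈T
  φ : (Fin n → Fin n → ℕ) → Fin n → ℚ
  φ x j = ℕ→ℚ (x i j)
  valid-at-vertex : ∀ x → Feasible n k w WL WU x → wSet w T ≤ w i + dot coeff (φ x)
  valid-at-vertex x x-feasible =
    valid-at-row WL<wT (x i) (binary i) (wtL i) (ℕP.≤-trans ∣T∣≤F-L (degL i))
    where open Feasible x-feasible
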